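{- Let $G$ be a finite simple graph with $n$ vertices that has at least two independent edges (two edges with no common endpoint). Then $D_{n-1}(G)$ is connected.
   Context: A set $S \subseteq V(G)$ is a dominating set of $G$ if every vertex of $V(G)\setminus S$ is adjacent to a vertex of $S$. For an integer $k$ at least the domination number of $G$, the $k$-dominating graph $D_k(G)$ is the graph whose vertices are the dominating sets of $G$ of cardinality at most $k$, two such sets $A,B$ being adjacent if and only if their symmetric difference $(A\setminus B)\cup(B\setminus A)$ consists of exactly one vertex of $G$. -}

module Defs where

open import Data.Nat using (ℕ; _≤_; _∸_)
open import Data.Fin using (Fin)
open import Data.Fin.Subset using (Subset; _∈_; ∣_∣)
open import Data.Vec using (lookup)
open import Data.Product using (Σ; ∃; ∃-syntax; _×_; _,_; proj₁)
open import Data.Sum using (_⊎_)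
open import Data.Empty using (⊥)
open import Relation.Nullary using (¬_; Dec)
open import Relation.Binary.PropositionalEquality using (_≡_; _≢_)
open import Relation.Binary.Construct.Closure.ReflexiveTransitive using (Star)

record SimpleGraph (n : ℕ) : Set₁ where
  field
    Adj    : Fin n → Fin n → Set
    sym    : ∀ {u v} → Adj u v → Adj v u
    irrefl : ∀ {u} → ¬ Adj u u
    dec    : ∀ u v → Dec (Adj u v)
open SimpleGraph public

HasTwoIndependentEdges : ∀ {n} → SimpleGraph n → Set
HasTwoIndependentEdges {n} G =
  ∃[ a ] ∃[ b ] ∃[ c ] ∃[ d ]
    (Adj G a b × Adj G c d × a ≢ c × a ≢ d × b ≢ c × b ≢ d)

IsDominating : ∀ {n} → SimpleGraph n → Subset n → Set
IsDominating {n} G S = ∀ (v : Fin n) → ¬ (v ∈ S) → ∃[ u ] (u ∈ S × Adj G v u)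

IsDkVertex : ∀ {n} → SimpleGraph n → ℕ → Subset n → Set
IsDkVertex G k S = IsDominating G S × ∣ S ∣ ≤ k

DkVertex : ∀ {n} → SimpleGraph n → ℕ → Set
DkVertex {n} G k = Σ (Subset n) (IsDkVertex G k)

SymDiffSingleton : ∀ {n} → Subset n → Subset n → Set
SymDiffSingleton {n} A B =
  ∃[ v ] (lookup A v ≢ lookup B v × (∀ w → w ≢ v → lookup A w ≡ lookup B w))

DkAdj : ∀ {n} (G : SimpleGraph n) (k : ℕ) → DkVertex G k → DkVertex G k → Set
DkAdj G k A B = SymDiffSingleton (proj₁ A) (proj₁ B)

DkConnected : ∀ {n} → SimpleGraph n → ℕ → Set
DkConnected G k =
  DkVertex G k × (∀ (A B : DkVertex G k) → Star (DkAdj G k) A B)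

module Submission where

-- Write V∖u for the set of all vertices but u; it dominates G as soon as u
-- has a neighbour, and it has the maximal admissible size n - 1.  The walk
-- between two dominating sets is built from three facts.
--   * Growing: a dominating set X can be enlarged one vertex at a time to any
--     superset T of size at most k; every intermediate set still dominates,
--     so this is a walk in D_k (well-founded induction on ⊂).
--   * Swapping: if u ≠ x, u has a neighbour other than x and x has a
--     neighbour other than u, then V∖{u,x} dominates, so V∖u — V∖{u,x} — V∖x
--     is a walk of length two.
--   * Hub: with the independent edges ab, cd every V∖u with u non-isolated is
--     swapped to the hub V∖a, directly or through V∖c.
-- A vertex X of D_{n-1} misses some vertex u, which has a neighbour in X
-- since X dominates; growing X to V∖u and swapping to the hub connects X to
-- the hub, and any two vertices are joined through it.

open import Defs renaming (sym to Adj-sym)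
open import Data.Nat using (ℕ; suc; _∸_; _≤_; _<_; s≤s)
open import Data.Nat.Properties using (<-irrefl; ≤-refl; ≤-trans)
open import Data.Fin using (Fin; zero; suc; _≟_)
open import Data.Fin.Properties using (any?)
open import Data.Fin.Subset
  using (Subset; inside; outside; _∈_; _∉_; _⊆_; _⊂_; _⊃_; ⊤; ⁅_⁆; _∪_; _-_; ∣_∣)
open import Data.Fin.Subset.Properties
  using ( _∈?_; ∈⊤; ⊆⊤; ∣⊤∣≡n; ⊆-antisym; x∈⁅x⁆; x∈⁅y⁆⇒x≡y; p⊆p∪q; x∈p∪q⁺
        ; x∈p∪q⁻; p⊆q⇒∣p∣≤∣q∣; p─q⊆p; ∣p─q∣≤∣p∣; x∈p∧x≢y⇒x∈p-y; p─x─y≡p─y─x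
        ; x∈p⇒∣p-x∣<∣p∣ )
open import Data.Fin.Subset.Induction using (⊃-wellFounded)
open import Data.Vec using (_∷_; lookup; there)
open import Data.Vec.Properties using ([]=⇒lookup; lookup⇒[]=)
open import Data.Product using (∃; _×_; _,_; proj₁)
open import Data.Sum using (inj₂; [_,_])
open import Data.Empty using (⊥-elim)
open import Function using (id; _∘_)
open import Induction.WellFounded using (Acc; acc)
open import Relation.Nullary using (yes; no; contradiction)
open import Relation.Nullary.Decidable using (¬?; _×-dec_; decidable-stable)
open import Relation.Binary.PropositionalEquality
  using (_≡_; _≢_; refl; sym; trans; subst; cong)
open import Relation.Binary.Construct.Closure.ReflexiveTransitive
  using (Star; ε; _◅_; _◅◅_; reverse)

private variable
  n : ℕ
  p q : Subset n
  u w x y z : Fin n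

x∉p-x : ∀ (p : Subset n) x → x ∉ p - x
x∉p-x (_ ∷ _) zero ()
x∉p-x (_ ∷ p) (suc x) (there x∈p-x) = x∉p-x p x x∈p-x

∉⇒lookup≡outside : x ∉ p → lookup p x ≡ outside
∉⇒lookup≡outside {x = x} {p = p} x∉p with lookup p x in eq
... | outside = refl
... | inside  = contradiction (lookup⇒[]= x p eq) x∉p

lookup-≡ : (x ∈ p → x ∈ q) → (x ∈ q → x ∈ p) → lookup p x ≡ lookup q x
lookup-≡ {x = x} {p = p} p⇒q q⇒p with x ∈? p
... | yes x∈p = trans ([]=⇒lookup x∈p) (sym ([]=⇒lookup (p⇒q x∈p)))
... | no x∉p  = trans (∉⇒lookup≡outside x∉p) (sym (∉⇒lookup≡outside (x∉p ∘ q⇒p)))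

lookup-≢ : x ∈ p → x ∉ q → lookup p x ≢ lookup q x
lookup-≢ {x = x} {q = q} x∈p x∉q p≡q =
  x∉q (lookup⇒[]= x q (trans (sym p≡q) ([]=⇒lookup x∈p)))

symDiffSingleton-sym : SymDiffSingleton p q → SymDiffSingleton q p
symDiffSingleton-sym (v , differ , agree) =
  v , differ ∘ sym , λ w w≢v → sym (agree w w≢v)

one-point-extension : x ∉ p → x ∈ q → p ⊆ q → (∀ {y} → y ∈ q → y ≢ x → y ∈ p) →
                      SymDiffSingleton p q
one-point-extension {x = x} x∉p x∈q p⊆q q⊆p+x =
  x , (λ p≡q → lookup-≢ x∈q x∉p (sym p≡q))
    , λ y y≢x → lookup-≡ p⊆q (λ y∈q → q⊆p+x y∈q y≢x)

removal-adjacent : x ∈ p → SymDiffSingleton (p - x) p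
removal-adjacent {x = x} {p = p} x∈p =
  one-point-extension (x∉p-x p x) x∈p (p─q⊆p p ⁅ x ⁆) x∈p∧x≢y⇒x∈p-y

∪⁅⁆⊆ : p ⊆ q → x ∈ q → p ∪ ⁅ x ⁆ ⊆ q
∪⁅⁆⊆ {p = p} {q = q} {x = x} p⊆q x∈q y∈ =
  [ p⊆q , (λ y∈⁅x⁆ → subst (_∈ q) (sym (x∈⁅y⁆⇒x≡y x y∈⁅x⁆)) x∈q) ] (x∈p∪q⁻ p ⁅ x ⁆ y∈)

insertion-adjacent : x ∉ p → SymDiffSingleton p (p ∪ ⁅ x ⁆)
insertion-adjacent {x = x} {p = p} x∉p =
  one-point-extension x∉p (x∈p∪q⁺ (inj₂ (x∈⁅x⁆ x))) (p⊆p∪q ⁅ x ⁆) in-p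
  where
  in-p : ∀ {y} → y ∈ p ∪ ⁅ x ⁆ → y ≢ x → y ∈ p
  in-p y∈ y≢x = [ id , ⊥-elim ∘ y≢x ∘ x∈⁅y⁆⇒x≡y x ] (x∈p∪q⁻ p ⁅ x ⁆ y∈)

p⊂p∪⁅x⁆ : x ∉ p → p ⊂ p ∪ ⁅ x ⁆
p⊂p∪⁅x⁆ {x = x} x∉p = p⊆p∪q ⁅ x ⁆ , x , x∈p∪q⁺ (inj₂ (x∈⁅x⁆ x)) , x∉p

<⇒≤∸1 : ∀ {m n} → m < n → m ≤ n ∸ 1
<⇒≤∸1 {n = suc _} (s≤s m≤n) = m≤n

≤∸1⇒< : ∀ {m} → Fin n → m ≤ n ∸ 1 → m < n
≤∸1⇒< {n = suc _} _ m≤n = s≤s m≤n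

∣⊤-x∣≤n∸1 : ∀ (x : Fin n) → ∣ ⊤ - x ∣ ≤ n ∸ 1
∣⊤-x∣≤n∸1 {n} x =
  <⇒≤∸1 (subst (∣ ⊤ - x ∣ <_) (∣⊤∣≡n n) (x∈p⇒∣p-x∣<∣p∣ {x = x} {p = ⊤ {n}} ∈⊤))

∈⊤-x-y : x ≢ u → x ≢ y → x ∈ ⊤ - u - y
∈⊤-x-y x≢u x≢y = x∈p∧x≢y⇒x∈p-y (x∈p∧x≢y⇒x∈p-y ∈⊤ x≢u) x≢y

p⊆⊤-x : x ∉ p → p ⊆ ⊤ - x
p⊆⊤-x {p = p} x∉p y∈p = x∈p∧x≢y⇒x∈p-y ∈⊤ (λ y≡x → x∉p (subst (_∈ p) y≡x y∈p))

missing-element : ∀ (p : Subset n) → ∣ p ∣ < n → ∃ λ x → x ∉ p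
missing-element {n} p ∣p∣<n with any? (λ x → ¬? (x ∈? p))
... | yes missing = missing
... | no  none    = contradiction ∣p∣<n (<-irrefl ∣p∣≡n)
  where
  ⊤⊆p : ⊤ ⊆ p
  ⊤⊆p {x} _ = decidable-stable (x ∈? p) (λ x∉p → none (x , x∉p))
  ∣p∣≡n : ∣ p ∣ ≡ n
  ∣p∣≡n = trans (cong ∣_∣ (⊆-antisym ⊆⊤ ⊤⊆p)) (∣⊤∣≡n n)

module Domination (G : SimpleGraph n) where

  neighbour-≢ : Adj G u w → w ≢ u
  neighbour-≢ uw refl = irrefl G uw

  dominating-⊆ : p ⊆ q → IsDominating G p → IsDominating G q
  dominating-⊆ p⊆q p-dom v v∉q with p-dom v (v∉q ∘ p⊆q)
  ... | u , u∈p , vu = u , p⊆q u∈p , vu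

  -- V∖{u,x} dominates when u has a neighbour w ≠ x and x a neighbour y ≠ u:
  -- only u and x need dominating, and w, y are kept.
  co-pair-dominating : Adj G u w → w ≢ x → Adj G x y → y ≢ u →
                       IsDominating G (⊤ - u - x)
  co-pair-dominating {u} {w} {x} {y} uw w≢x xy y≢u v v∉ with v ≟ u | v ≟ x
  ... | yes refl | _        = w , ∈⊤-x-y (neighbour-≢ uw) w≢x , uw
  ... | no _     | yes refl = y , ∈⊤-x-y y≢u (neighbour-≢ xy) , xy
  ... | no v≢u   | no v≢x   = contradiction (∈⊤-x-y v≢u v≢x) v∉

  co-dominating : Adj G u w → IsDominating G (⊤ - u)
  co-dominating {u} uw =
    dominating-⊆ (p─q⊆p (⊤ - u) ⁅ u ⁆)
      (co-pair-dominating uw (neighbour-≢ uw) uw (neighbour-≢ uw))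

module Walks (G : SimpleGraph n) (k : ℕ) where
  open Domination G

  Dk : Set
  Dk = DkVertex G k

  R : Dk → Dk → Set
  R = DkAdj G k

  R-sym : ∀ {X Y} → R X Y → R Y X
  R-sym {X} {Y} = symDiffSingleton-sym {p = proj₁ X} {q = proj₁ Y}

  -- A vertex X of D_k can be grown one element at a time to (a vertex over)
  -- any superset T of size at most k; intermediate sets dominate as
  -- supersets of X and are bounded by ∣ T ∣.
  grow : (X : Dk) (T : Subset n) → proj₁ X ⊆ T → ∣ T ∣ ≤ k →
         ∃ λ Y → proj₁ Y ≡ T × Star R X Y
  grow X T X⊆T ∣T∣≤k = go X X⊆T (⊃-wellFounded (proj₁ X))
    where
    go : (X : Dk) → proj₁ X ⊆ T → Acc _⊃_ (proj₁ X) →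
         ∃ λ Y → proj₁ Y ≡ T × Star R X Y
    go X@(p , p-dom , _) p⊆T (acc smaller)
      with any? (λ v → v ∈? T ×-dec ¬? (v ∈? p))
    ... | no none = X , ⊆-antisym p⊆T T⊆p , ε
      where
      T⊆p : T ⊆ p
      T⊆p {v} v∈T = decidable-stable (v ∈? p) (λ v∉p → none (v , v∈T , v∉p))
    ... | yes (v , v∈T , v∉p) with go X′ p′⊆T (smaller (p⊂p∪⁅x⁆ v∉p))
      where
      p′⊆T : p ∪ ⁅ v ⁆ ⊆ T
      p′⊆T = ∪⁅⁆⊆ p⊆T v∈T
      X′ : Dk
      X′ = p ∪ ⁅ v ⁆ , dominating-⊆ (p⊆p∪q ⁅ v ⁆) p-dom
                     , ≤-trans (p⊆q⇒∣p∣≤∣q∣ p′⊆T) ∣T∣≤k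
    ... | Y , Y≡T , walk = Y , Y≡T , insertion-adjacent v∉p ◅ walk

module CoSingletons (G : SimpleGraph n) (k : ℕ) (n∸1≤k : n ∸ 1 ≤ k) where
  open Domination G
  open Walks G k

  coVertex : Adj G u w → Dk
  coVertex {u} uw = ⊤ - u , co-dominating uw , ≤-trans (∣⊤-x∣≤n∸1 u) n∸1≤k

  Joined : Fin n → Fin n → Set
  Joined u x = ∀ (X Y : Dk) → proj₁ X ≡ ⊤ - u → proj₁ Y ≡ ⊤ - x → Star R X Y

  joined-by-neighbours : u ≢ x → Adj G u w → w ≢ x → Adj G x y → y ≢ u →
                         Joined u x
  joined-by-neighbours {u} {x} u≢x uw w≢x xy y≢u (_ , _) Y@(_ , _) refl refl =
    _◅_ {j = M} drop-x (_◅_ {j = Y} add-u ε)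
    where
    x≢u : x ≢ u
    x≢u = u≢x ∘ sym
    M : Dk
    M = ⊤ - u - x , co-pair-dominating uw w≢x xy y≢u
      , ≤-trans (∣p─q∣≤∣p∣ (⊤ - u) ⁅ x ⁆) (≤-trans (∣⊤-x∣≤n∸1 u) n∸1≤k)
    drop-x : SymDiffSingleton (⊤ - u) (⊤ - u - x)
    drop-x = symDiffSingleton-sym {p = ⊤ - u - x} {q = ⊤ - u}
               (removal-adjacent (x∈p∧x≢y⇒x∈p-y ∈⊤ x≢u))
    add-u : SymDiffSingleton (⊤ - u - x) (⊤ - x)
    add-u = subst (λ s → SymDiffSingleton s (⊤ - x)) (p─x─y≡p─y─x ⊤ x u)
                  (removal-adjacent (x∈p∧x≢y⇒x∈p-y ∈⊤ u≢x))

  joined-to-edge : Adj G x y → u ≢ x → u ≢ y → Adj G u w → w ≢ x → Joined u x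
  joined-to-edge xy u≢x u≢y uw w≢x = joined-by-neighbours u≢x uw w≢x xy (u≢y ∘ sym)

  joined-trans : Joined u x → Adj G x z → Joined x y → Joined u y
  joined-trans u~x xz x~y X Y X≡ Y≡ =
    u~x X (coVertex xz) X≡ refl ◅◅ x~y (coVertex xz) Y refl Y≡

module Hub (G : SimpleGraph n) {a b c d : Fin n} (ab : Adj G a b) (cd : Adj G c d)
           (a≢c : a ≢ c) (a≢d : a ≢ d) (b≢c : b ≢ c) (b≢d : b ≢ d) where
  open Walks G (n ∸ 1)
  open CoSingletons G (n ∸ 1) ≤-refl

  -- c lies off the edge ab and has the neighbour d ≠ a.
  c~a : Joined c a
  c~a = joined-to-edge ab (a≢c ∘ sym) (b≢c ∘ sym) cd (a≢d ∘ sym)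

  via-c : u ≢ c → u ≢ d → Adj G u w → w ≢ c → Joined u a
  via-c u≢c u≢d uw w≢c = joined-trans (joined-to-edge cd u≢c u≢d uw w≢c) cd c~a

  joined-to-hub : Adj G u w → Joined u a
  joined-to-hub {u} {w} uw with u ≟ a | u ≟ b
  ... | yes refl | _        = via-c a≢c a≢d ab b≢c
  ... | no _     | yes refl = via-c b≢c b≢d (Adj-sym G ab) a≢c
  ... | no u≢a   | no u≢b with w ≟ a
  ...   | no w≢a = joined-to-edge ab u≢a u≢b uw w≢a
  ...   | yes refl with u ≟ c | u ≟ d
  ...     | yes refl | _        = c~a
  ...     | no _     | yes refl = joined-to-edge ab u≢a u≢b (Adj-sym G cd) (a≢c ∘ sym)
  ...     | no u≢c   | no u≢d   = via-c u≢c u≢d uw a≢c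

  hub : Dk
  hub = coVertex ab

  to-hub : (X : Dk) → Star R X hub
  to-hub X@(p , p-dom , ∣p∣≤n∸1) with missing-element p (≤∸1⇒< a ∣p∣≤n∸1)
  ... | u , u∉p with p-dom u u∉p | grow X (⊤ - u) (p⊆⊤-x u∉p) (∣⊤-x∣≤n∸1 u)
  ... | _ , _ , uw | Y , Y≡⊤-u , X→Y = X→Y ◅◅ joined-to-hub uw Y hub Y≡⊤-u refl

lemma2 : ∀ (n : ℕ) (G : SimpleGraph n) → HasTwoIndependentEdges G → DkConnected G (n ∸ 1)
lemma2 n G (a , b , c , d , ab , cd , a≢c , a≢d , b≢c , b≢d) =
  hub , λ A B → to-hub A ◅◅ reverse (λ {X} {Y} → R-sym {X} {Y}) (to-hub B)
  where
  open Walks G (n ∸ 1) using (R-sym)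
  open Hub G ab cd a≢c a≢d b≢c b≢d using (hub; to-hub)
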